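{- Let ${\sf V}$ be a quantale and $X$ a set. A map $c:{\sf P}X\to{\sf V}^X$ is a ${\sf V}$-valued closure space structure on $X$ if and only if $c_{\rm disc}^!\circ{\sf y}_{{\sf V}^X}\circ c=c^!\circ{\sf y}_{{\sf V}^X}\circ c$ as maps ${\sf P}X\to{\sf V}^{{\sf P}X}$ (equivalently, as ${\sf V}$-functors), i.e. for all $A\subseteq X$ the functions $B\mapsto[c_{\rm disc}B,cA]$ and $B\mapsto[cB,cA]$ on ${\sf P}X$ coincide. Moreover, a ${\sf V}$-valued closure space structure $c$ makes $X$ a ${\sf V}$-valued topological space if and only if $c$ preserves finite suprema.
   Context: A quantale ${\sf V}=({\sf V},\otimes,{\sf k})$ is a complete lattice with a (not necessarily commutative) monoid structure $(\otimes,{\sf k})$ such that $\otimes$ preserves arbitrary suprema in each variable. ${\sf P}X$ is the power set of $X$ (ordered by inclusion), ${\sf V}^X$ the set of maps $X\to{\sf V}$ (ordered pointwise). A ${\sf V}$-valued closure space structure on $X$ is a map $c:{\sf P}X\to{\sf V}^X$ with (R) ${\sf k}\le (cA)(x)$ whenever $x\in A\subseteq X$, and (T) $\big(\bigwedge_{y\in B}(cA)(y)\big)\otimes (cB)(x)\le (cA)(x)$ for all $A,B\subseteq X$, $x\in X$; it is a ${\sf V}$-valued topological structure if also $(c\emptyset)(x)=\bot$ and $c(A\cup B)(x)=(cA)(x)\vee(cB)(x)$. For $v,w\in{\sf V}$, $[v,w]$ is defined by $u\le[v,w]\iff u\otimes v\le w$; for $\sigma,\tau\in{\sf V}^X$,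 $[\sigma,\tau]=\bigwedge_{x}[\sigma(x),\tau(x)]$. $c_{\rm disc}:{\sf P}X\to{\sf V}^X$ is $(c_{\rm disc}A)(x)={\sf k}$ if $x\in A$, $\bot$ otherwise. The Yoneda map ${\sf y}_{{\sf V}^X}:{\sf V}^X\to{\sf V}^{{\sf V}^X}$ sends $\tau$ to $[-,\tau]$. For a map $g:S\to T$, $g^!:{\sf V}^T\to{\sf V}^S$ is $\Phi\mapsto\Phi\circ g$. -}

module Defs where

open import Level using (0ℓ)
open import Data.Bool using (Bool; true; false)
open import Data.Empty using (⊥)
open import Data.Product using (Σ; _×_; _,_; proj₁)
open import Data.Sum using (_⊎_)
open import Relation.Unary using (Pred; _∈_)
open import Relation.Binary.PropositionalEquality using (_≡_)

record Quantale : Set₁ where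
  infixl 7 _⊗_
  infix 4 _≤_
  field
    Carrier  : Set
    _≤_      : Carrier → Carrier → Set
    ≤-refl   : ∀ {a} → a ≤ a
    ≤-trans  : ∀ {a b c} → a ≤ b → b ≤ c → a ≤ c
    ≤-antisym : ∀ {a b} → a ≤ b → b ≤ a → a ≡ b
    ⋁        : {I : Set} → (I → Carrier) → Carrier
    ⋁-ub     : ∀ {I : Set} (f : I → Carrier) (i : I) → f i ≤ ⋁ f
    ⋁-least  : ∀ {I : Set} (f : I → Carrier) (a : Carrier) → (∀ i → f i ≤ a) → ⋁ f ≤ a
    ⋀        : {I : Set} → (I → Carrier) → Carrier
    ⋀-lb     : ∀ {I : Set} (f : I → Carrier) (i : I) → ⋀ f ≤ f i
    ⋀-greatest : ∀ {I : Set} (f : I → Carrier) (a : Carrier) → (∀ i → a ≤ f i) → a ≤ ⋀ f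
    _⊗_      : Carrier → Carrier → Carrier
    k        : Carrier
    ⊗-assoc  : ∀ a b c → (a ⊗ b) ⊗ c ≡ a ⊗ (b ⊗ c)
    ⊗-identityˡ : ∀ a → k ⊗ a ≡ a
    ⊗-identityʳ : ∀ a → a ⊗ k ≡ a
    ⊗-⋁ˡ     : ∀ {I : Set} (f : I → Carrier) (a : Carrier) → (⋁ f) ⊗ a ≡ ⋁ (λ i → f i ⊗ a)
    ⊗-⋁ʳ     : ∀ {I : Set} (a : Carrier) (f : I → Carrier) → a ⊗ (⋁ f) ≡ ⋁ (λ i → a ⊗ f i)

  ⊥V : Carrier
  ⊥V = ⋁ {⊥} (λ ())

  _∨_ : Carrier → Carrier → Carrier
  a ∨ b = ⋁ {Bool} (λ { true → a ; false → b })

  [_,_] : Carrier → Carrier → Carrier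
  [ v , w ] = ⋁ {Σ Carrier (λ u → u ⊗ v ≤ w)} proj₁

module _ (V : Quantale) (X : Set) where
  open Quantale V

  PX : Set₁
  PX = Pred X 0ℓ

  VX : Set
  VX = X → Carrier

  ∅ : PX
  ∅ = λ _ → ⊥

  _∪_ : PX → PX → PX
  A ∪ B = λ x → A x ⊎ B x

  homVX : VX → VX → Carrier
  homVX σ τ = ⋀ (λ x → [ σ x , τ x ])

  -- c_disc A x = k if x ∈ A, ⊥ otherwise (written as the supremum of k over
  -- the proofs of x ∈ A, which avoids deciding membership)
  cdisc : PX → VX
  cdisc A x = ⋁ {x ∈ A} (λ _ → k)

  IsClosure : (PX → VX) → Set₁
  IsClosure c =
    (∀ (A : PX) (x : X) → x ∈ A → k ≤ c A x) ×
    (∀ (A B : PX) (x : X) →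
       ⋀ {Σ X (λ y → y ∈ B)} (λ p → c A (proj₁ p)) ⊗ c B x ≤ c A x)

  PreservesFiniteSups : (PX → VX) → Set₁
  PreservesFiniteSups c =
    (∀ (x : X) → c ∅ x ≡ ⊥V) ×
    (∀ (A B : PX) (x : X) → c (A ∪ B) x ≡ c A x ∨ c B x)

  IsTopological : (PX → VX) → Set₁
  IsTopological c = IsClosure c × PreservesFiniteSups c

  -- c_disc^! ∘ y ∘ c = c^! ∘ y ∘ c, pointwise: for all A, B,
  -- [c_disc B , c A] = [c B , c A]
  YonedaCondition : (PX → VX) → Set₁
  YonedaCondition c = ∀ (A B : PX) → homVX (cdisc B) (c A) ≡ homVX (c B) (c A)

-- Writing ⋀_B τ for the meet of τ over B, the quantale adjunction gives
-- [c_disc B , τ] = ⋀_B τ. Hence the Yoneda condition says exactly that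
-- ⋀_B (c A) = [c B , c A] for all A, B. The inequality ≤ is the transitivity
-- axiom (T) read through the adjunction; the inequality ≥ follows from
-- reflexivity (R), since (R) says c_disc B ≤ c B and [- , c A] is antitone.
-- Conversely (R) is recovered from k ≤ [c A , c A] = ⋀_A (c A).
module Submission where

open import Defs
open import Data.Bool using (true; false)
open import Data.Product using (_×_; _,_; proj₁; proj₂; Σ)
open import Function.Bundles using (_⇔_; mk⇔; Equivalence)
open import Relation.Binary.PropositionalEquality using (_≡_; subst; sym; cong)
open import Relation.Unary using (_∈_)

module QuantaleProperties (V : Quantale) where
  open Quantale V

  ≤-reflexive : ∀ {a b} → a ≡ b → a ≤ b
  ≤-reflexive a≡b = subst (_ ≤_) a≡b ≤-refl

  ≤-ext : ∀ {a b} → (∀ u → u ≤ a ⇔ u ≤ b) → a ≡ b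
  ≤-ext ext = ≤-antisym (Equivalence.to (ext _) ≤-refl) (Equivalence.from (ext _) ≤-refl)

  ≤-⋀⇔ : ∀ {I : Set} {f : I → Carrier} {u} → u ≤ ⋀ f ⇔ (∀ i → u ≤ f i)
  ≤-⋀⇔ {f = f} = mk⇔ (λ u≤⋀ i → ≤-trans u≤⋀ (⋀-lb f i)) (⋀-greatest f _)

  ≤⇒∨≡ʳ : ∀ {a b} → a ≤ b → a ∨ b ≡ b
  ≤⇒∨≡ʳ a≤b = ≤-antisym (⋁-least _ _ (λ { true → a≤b ; false → ≤-refl })) (⋁-ub _ false)

  ⊗-monoˡ : ∀ {a b} c → a ≤ b → a ⊗ c ≤ b ⊗ c
  ⊗-monoˡ {a} {b} c a≤b =
    ≤-trans (⋁-ub _ true)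
      (≤-trans (≤-reflexive (sym (⊗-⋁ˡ _ c))) (≤-reflexive (cong (_⊗ c) (≤⇒∨≡ʳ {a} {b} a≤b))))

  ⊗-monoʳ : ∀ c {a b} → a ≤ b → c ⊗ a ≤ c ⊗ b
  ⊗-monoʳ c {a} {b} a≤b =
    ≤-trans (⋁-ub _ true)
      (≤-trans (≤-reflexive (sym (⊗-⋁ʳ c _))) (≤-reflexive (cong (c ⊗_) (≤⇒∨≡ʳ {a} {b} a≤b))))

  residual⇔ : ∀ {u v w} → u ≤ [ v , w ] ⇔ u ⊗ v ≤ w
  residual⇔ {v = v} {w} = mk⇔
    (λ u≤[v,w] → ≤-trans (⊗-monoˡ v u≤[v,w])
      (≤-trans (≤-reflexive (⊗-⋁ˡ _ v)) (⋁-least _ w proj₂)))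
    (λ u⊗v≤w → ⋁-ub proj₁ (_ , u⊗v≤w))

module ClosureProperties (V : Quantale) (X : Set) where
  open Quantale V
  open QuantaleProperties V

  ⋀∈ : PX V X → VX V X → Carrier
  ⋀∈ B τ = ⋀ {Σ X (_∈ B)} (λ p → τ (proj₁ p))

  homVX-residual⇔ : ∀ {u σ τ} → u ≤ homVX V X σ τ ⇔ (∀ x → u ⊗ σ x ≤ τ x)
  homVX-residual⇔ = mk⇔
    (λ u≤hom x → Equivalence.to residual⇔ (Equivalence.to ≤-⋀⇔ u≤hom x))
    (λ u⊗σ≤τ → Equivalence.from ≤-⋀⇔ (λ x → Equivalence.from residual⇔ (u⊗σ≤τ x)))

  homVX-refl : ∀ σ → k ≤ homVX V X σ σ
  homVX-refl σ = Equivalence.from homVX-residual⇔ (λ x → ≤-reflexive (⊗-identityˡ (σ x)))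

  homVX-antitoneˡ : ∀ {σ σ′} τ → (∀ x → σ x ≤ σ′ x) → homVX V X σ′ τ ≤ homVX V X σ τ
  homVX-antitoneˡ τ σ≤σ′ = Equivalence.from homVX-residual⇔ λ x →
    ≤-trans (⊗-monoʳ _ (σ≤σ′ x)) (Equivalence.to homVX-residual⇔ ≤-refl x)

  cdisc-least : ∀ (B : PX V X) {σ : VX V X} → (∀ x → x ∈ B → k ≤ σ x) → ∀ x → cdisc V X B x ≤ σ x
  cdisc-least B {σ} k≤σ x = ⋁-least _ (σ x) (k≤σ x)

  ⊗-cdisc-≤⇔ : ∀ {u} (B : PX V X) {x v} → u ⊗ cdisc V X B x ≤ v ⇔ (x ∈ B → u ≤ v)
  ⊗-cdisc-≤⇔ {u} B {v = v} = mk⇔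
    (λ u⊗δ≤v x∈B → ≤-trans (≤-reflexive (sym (⊗-identityʳ u)))
      (≤-trans (⊗-monoʳ u (⋁-ub _ x∈B)) u⊗δ≤v))
    (λ u≤v → ≤-trans (≤-reflexive (⊗-⋁ʳ u _))
      (⋁-least _ v (λ x∈B → ≤-trans (≤-reflexive (⊗-identityʳ u)) (u≤v x∈B))))

  homVX-cdisc : ∀ (B : PX V X) τ → homVX V X (cdisc V X B) τ ≡ ⋀∈ B τ
  homVX-cdisc B τ = ≤-ext λ u → mk⇔
    (λ u≤hom → Equivalence.from ≤-⋀⇔ λ { (y , y∈B) →
      Equivalence.to (⊗-cdisc-≤⇔ B) (Equivalence.to homVX-residual⇔ u≤hom y) y∈B })
    (λ u≤⋀ → Equivalence.from homVX-residual⇔ λ x →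
      Equivalence.from (⊗-cdisc-≤⇔ B) (λ x∈B → Equivalence.to ≤-⋀⇔ u≤⋀ (x , x∈B)))

  closure⇒yoneda : ∀ c → IsClosure V X c → YonedaCondition V X c
  closure⇒yoneda c (refl-c , trans-c) A B =
    subst (_≡ homVX V X (c B) (c A)) (sym (homVX-cdisc B (c A))) (≤-antisym ⋀∈≤hom hom≤⋀∈)
    where
    ⋀∈≤hom : ⋀∈ B (c A) ≤ homVX V X (c B) (c A)
    ⋀∈≤hom = Equivalence.from homVX-residual⇔ (trans-c A B)

    hom≤⋀∈ : homVX V X (c B) (c A) ≤ ⋀∈ B (c A)
    hom≤⋀∈ = subst (homVX V X (c B) (c A) ≤_) (homVX-cdisc B (c A))
      (homVX-antitoneˡ (c A) (cdisc-least B (refl-c B)))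

  yoneda⇒closure : ∀ c → YonedaCondition V X c → IsClosure V X c
  yoneda⇒closure c yoneda = refl-c , trans-c
    where
    ⋀∈≡hom : ∀ A B → ⋀∈ B (c A) ≡ homVX V X (c B) (c A)
    ⋀∈≡hom A B = subst (_≡ homVX V X (c B) (c A)) (homVX-cdisc B (c A)) (yoneda A B)

    refl-c : ∀ A x → x ∈ A → k ≤ c A x
    refl-c A x x∈A = Equivalence.to ≤-⋀⇔
      (subst (k ≤_) (sym (⋀∈≡hom A A)) (homVX-refl (c A))) (x , x∈A)

    trans-c : ∀ A B x → ⋀∈ B (c A) ⊗ c B x ≤ c A x
    trans-c A B = Equivalence.to homVX-residual⇔ (≤-reflexive (⋀∈≡hom A B))

corollary5p3 : (V : Quantale) (X : Set) (c : PX V X → VX V X) →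
    (IsClosure V X c ⇔ YonedaCondition V X c) ×
    (IsClosure V X c → (IsTopological V X c ⇔ PreservesFiniteSups V X c))
corollary5p3 V X c =
  mk⇔ (closure⇒yoneda c) (yoneda⇒closure c) , λ closure → mk⇔ proj₂ (closure ,_)
  where open ClosureProperties V X
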